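{- For every integer $n\geq 2$, the number $t(\overrightarrow{S_n},1)$ of directed spanning trees of $\overrightarrow{S_n}$ rooted by the vertex $1$ equals $J_{n-2}+J_{n-1}$.
   Context: The directed strip graph $\overrightarrow{S_k}$ has vertex set $\{1,2,\dots,k\}$ and edge set $\{(i,j)\mid 1\leq j-i\leq 2\}$. For a directed graph $\overrightarrow{G}$ and a vertex $u$, a directed spanning tree rooted by $u$ is a spanning subgraph $\overrightarrow{G'}$ (same vertex set, subset of the edges) such that: the underlying undirected graph of $\overrightarrow{G'}$ is connected; $\overrightarrow{G'}$ contains no closed paths; every vertex $v\neq u$ has in-degree $1$ in $\overrightarrow{G'}$; and for every vertex $v\neq u$ there is a directed path in $\overrightarrow{G'}$ from $u$ to $v$. $t(\overrightarrow{G},u)$ denotes the number of such trees. The Jacobsthal sequence is defined by $J_0=0$, $J_1=1$, $J_{m+2}=J_{m+1}+2J_m$ for $m\geq 0$. -}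

module Defs where

open import Data.Nat using (ℕ; zero; suc; _+_; _*_; _<_; _≤_)
open import Data.Bool using (Bool; true; false; if_then_else_)
open import Data.Fin using (Fin; toℕ)
open import Data.Vec using (Vec; lookup; map)
open import Data.Vec using () renaming (foldr′ to vfoldr)
open import Data.Product using (_×_; Σ)
open import Data.Sum using (_⊎_)
open import Data.Empty using (⊥)
open import Relation.Nullary using (¬_)
open import Relation.Binary.PropositionalEquality using (_≡_)

J : ℕ → ℕ
J 0 = 0
J 1 = 1
J (suc (suc m)) = J (suc m) + 2 * J m

-- Vertex i of the paper is  Fin k  index  i-1  (so vertex 1 is Fin.zero).
-- Edge (i , j) of the directed strip graph S_k : 1 ≤ j - i ≤ 2.
StripEdge : {k : ℕ} → Fin k → Fin k → Set
StripEdge i j = (toℕ i < toℕ j) × (toℕ j ≤ 2 + toℕ i)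

-- A spanning subgraph (same vertex set) is given by its edge set, encoded
-- as a k×k Boolean adjacency matrix: lookup (lookup A i) j ≡ true iff (i , j) ∈ E.
Adj : ℕ → Set
Adj k = Vec (Vec Bool k) k

HasEdge : {k : ℕ} → Adj k → Fin k → Fin k → Set
HasEdge A i j = lookup (lookup A i) j ≡ true

SubgraphOfStrip : {k : ℕ} → Adj k → Set
SubgraphOfStrip {k} A = (i j : Fin k) → HasEdge A i j → StripEdge i j

data DWalk {k : ℕ} (A : Adj k) : Fin k → Fin k → Set where
  here : ∀ {v} → DWalk A v v
  step : ∀ {u v w} → HasEdge A u v → DWalk A v w → DWalk A u w

data UWalk {k : ℕ} (A : Adj k) : Fin k → Fin k → Set where
  here : ∀ {v} → UWalk A v v
  fwd  : ∀ {u v w} → HasEdge A u v → UWalk A v w → UWalk A u w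
  bwd  : ∀ {u v w} → HasEdge A v u → UWalk A v w → UWalk A u w

ClosedPath : {k : ℕ} → Adj k → Set
ClosedPath {k} A = Σ (Fin k) λ v → Σ (Fin k) λ w → HasEdge A v w × DWalk A w v

inDeg : {k : ℕ} → Adj k → Fin k → ℕ
inDeg A v = vfoldr _+_ 0 (map (λ row → if lookup row v then 1 else 0) A)

IsDirSpanningTree : {k : ℕ} → Adj k → Fin k → Set
IsDirSpanningTree {k} A u =
  SubgraphOfStrip A
  × ((v w : Fin k) → UWalk A v w)
  × ¬ ClosedPath A
  × ((v : Fin k) → ¬ (v ≡ u) → inDeg A v ≡ 1)
  × ((v : Fin k) → ¬ (v ≡ u) → DWalk A u v)

-- A spanning tree rooted at vertex 1 is determined by the parent of each other vertex, and every
-- assignment of parents along edges of the strip is a tree, since parents have smaller labels.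
-- In the strip, vertex 2 must hang from 1 while each vertex j ≥ 3 independently hangs from j - 1
-- or j - 2, so there are 2^(n-2) trees; and J (n-2) + J (n-1) = 2^(n-2).
module Submission where

open import Defs
open import Data.Nat using (ℕ; suc; _+_)
open import Data.Fin using (zero)
open import Data.List using (List; length)
open import Data.List.Membership.Propositional using (_∈_)
open import Data.List.Relation.Unary.Unique.Propositional using (Unique)
open import Data.Product using (Σ; _×_)
open import Function.Bundles using (_⇔_)
open import Relation.Binary.PropositionalEquality using (_≡_)

open import Data.Bool using (Bool; true; false; if_then_else_)
open import Data.Bool.Properties using (¬-not)
open import Data.Fin using (Fin; suc; toℕ; inject₁; _<_)
open import Data.Fin.Induction using (<-wellFounded)
open import Data.Fin.Properties using (_≟_; suc-injective; toℕ-inject₁)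
open import Data.List using ([]; _∷_; map; cartesianProductWith)
open import Data.List.Membership.Propositional.Properties
  using (∈-map⁺; ∈-map⁻; ∈-cartesianProductWith⁺)
open import Data.List.Properties using (length-map; length-++)
open import Data.List.Relation.Unary.Any using (here; there)
open import Data.List.Relation.Unary.All using ([]; _∷_)
open import Data.List.Relation.Unary.AllPairs using ([]; _∷_)
open import Data.List.Relation.Unary.Unique.Propositional.Properties
  using (map⁺; cartesianProductWith⁺)
open import Data.Nat using (zero; _≤_; _*_; _^_; s≤s)
open import Data.Nat.Properties using (n<1+n; n≤1+n; ≤-refl; ≤-trans; <⇒≤; <⇒≱)
  renaming (suc-injective to ℕ-suc-injective)
open import Data.Nat.Solver using (module +-*-Solver)
open import Data.Product using (_,_; proj₁; proj₂; ∃)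
open import Data.Sum using (_⊎_; inj₁; inj₂)
open import Data.Empty using (⊥-elim)
open import Data.Vec using (Vec; []; _∷_; lookup; tabulate; sum)
  renaming (map to vmap)
open import Data.Vec.Properties
  using (∷-injective; lookup-map; lookup∘tabulate; tabulate∘lookup; tabulate-cong; map-∘)
open import Function.Bundles using (mk⇔)
open import Induction.WellFounded using (Acc; acc)
open import Relation.Nullary using (¬_; does; yes)
open import Relation.Nullary.Decidable using (dec-true)
open import Relation.Binary.PropositionalEquality using (_≢_; refl; sym; trans; cong; cong₂; subst)

J+J-suc≡2^ : ∀ m → J m + J (suc m) ≡ 2 ^ m
J+J-suc≡2^ zero = refl
J+J-suc≡2^ (suc m) = trans (doubling (J m) (J (suc m))) (cong (2 *_) (J+J-suc≡2^ m))
  where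
  open +-*-Solver
  doubling : ∀ a b → b + (b + 2 * a) ≡ 2 * (a + b)
  doubling = solve 2 (λ a b → b :+ (b :+ con 2 :* a) := con 2 :* (a :+ b)) refl

length-cartesianProductWith : ∀ {A B C : Set} (f : A → B → C) xs ys →
  length (cartesianProductWith f xs ys) ≡ length xs * length ys
length-cartesianProductWith f [] ys = refl
length-cartesianProductWith f (x ∷ xs) ys =
  trans (length-++ (map (f x) ys))
        (cong₂ _+_ (length-map (f x) ys) (length-cartesianProductWith f xs ys))

boolVecs : ∀ n → List (Vec Bool n)
boolVecs zero = [] ∷ []
boolVecs (suc n) = cartesianProductWith _∷_ (true ∷ false ∷ []) (boolVecs n)

boolVecs-unique : ∀ n → Unique (boolVecs n)
boolVecs-unique zero = [] ∷ []
boolVecs-unique (suc n) =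
  cartesianProductWith⁺ _∷_ ∷-injective (((λ ()) ∷ []) ∷ [] ∷ []) (boolVecs-unique n)

boolVecs-complete : ∀ {n} (v : Vec Bool n) → v ∈ boolVecs n
boolVecs-complete [] = here refl
boolVecs-complete (b ∷ v) = ∈-cartesianProductWith⁺ _∷_ (bool∈ b) (boolVecs-complete v)
  where
  bool∈ : ∀ b → b ∈ true ∷ false ∷ []
  bool∈ true = here refl
  bool∈ false = there (here refl)

length-boolVecs : ∀ n → length (boolVecs n) ≡ 2 ^ n
length-boolVecs zero = refl
length-boolVecs (suc n) =
  trans (length-cartesianProductWith _∷_ (true ∷ false ∷ []) (boolVecs n))
        (cong (2 *_) (length-boolVecs n))

ones : ∀ {n} → Vec Bool n → ℕ
ones v = sum (vmap (λ b → if b then 1 else 0) v)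

IsIndicatorOf : ∀ {n} → Vec Bool n → Fin n → Set
IsIndicatorOf v p = ∀ i → lookup v i ≡ does (i ≟ p)

ones≡0⇒allFalse : ∀ {n} (v : Vec Bool n) → ones v ≡ 0 → ∀ i → lookup v i ≡ false
ones≡0⇒allFalse (false ∷ v) eq zero = refl
ones≡0⇒allFalse (false ∷ v) eq (suc i) = ones≡0⇒allFalse v eq i

allFalse⇒ones≡0 : ∀ {n} (v : Vec Bool n) → (∀ i → lookup v i ≡ false) → ones v ≡ 0
allFalse⇒ones≡0 [] _ = refl
allFalse⇒ones≡0 (b ∷ v) all rewrite all zero = allFalse⇒ones≡0 v (λ i → all (suc i))

ones≡1⇒indicator : ∀ {n} (v : Vec Bool n) → ones v ≡ 1 → ∃ (IsIndicatorOf v)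
ones≡1⇒indicator (true ∷ v) eq = zero , λ
  { zero → refl
  ; (suc i) → ones≡0⇒allFalse v (ℕ-suc-injective eq) i }
ones≡1⇒indicator (false ∷ v) eq with ones≡1⇒indicator v eq
... | p , ind = suc p , λ { zero → refl ; (suc i) → ind i }

indicator⇒ones≡1 : ∀ {n} (v : Vec Bool n) {p} → IsIndicatorOf v p → ones v ≡ 1
indicator⇒ones≡1 (b ∷ v) {zero} ind rewrite ind zero =
  cong suc (allFalse⇒ones≡0 v (λ i → ind (suc i)))
indicator⇒ones≡1 (b ∷ v) {suc p} ind rewrite ind zero =
  indicator⇒ones≡1 v (λ i → ind (suc i))

column : ∀ {k} → Adj k → Fin k → Vec Bool k
column A j = vmap (λ row → lookup row j) A

inDeg≡ones-column : ∀ {k} (A : Adj k) v → inDeg A v ≡ ones (column A v)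
inDeg≡ones-column A v = cong sum (map-∘ (λ b → if b then 1 else 0) (λ row → lookup row v) A)

lookup-column : ∀ {k} (A : Adj k) i j → lookup (column A j) i ≡ lookup (lookup A i) j
lookup-column A i j = lookup-map i (λ row → lookup row j) A

module _ {k} {A : Adj k} where

  snocᵈ : ∀ {u v w} → DWalk A u v → HasEdge A v w → DWalk A u w
  snocᵈ here e = step e here
  snocᵈ (step e′ p) e = step e′ (snocᵈ p e)

  reverseOnto : ∀ {u v w} → DWalk A u v → UWalk A u w → UWalk A v w
  reverseOnto here q = q
  reverseOnto (step e p) q = reverseOnto p (bwd e q)

  DWalk⇒UWalk : ∀ {u v} → DWalk A u v → UWalk A u v
  DWalk⇒UWalk here = here
  DWalk⇒UWalk (step e p) = fwd e (DWalk⇒UWalk p)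

  reachable⇒connected : ∀ {r} → (∀ v → DWalk A r v) → ∀ v w → UWalk A v w
  reachable⇒connected reach v w = reverseOnto (reach v) (DWalk⇒UWalk (reach w))

  module _ (strip : SubgraphOfStrip A) where

    DWalk⇒≤ : ∀ {u v} → DWalk A u v → toℕ u ≤ toℕ v
    DWalk⇒≤ here = ≤-refl
    DWalk⇒≤ (step {u} {v} e p) = ≤-trans (<⇒≤ (proj₁ (strip u v e))) (DWalk⇒≤ p)

    strip⇒acyclic : ¬ ClosedPath A
    strip⇒acyclic (v , w , e , p) = <⇒≱ (proj₁ (strip v w e)) (DWalk⇒≤ p)

lookup²∘tabulate² : ∀ {n} {B : Set} (f : Fin n → Fin n → B) i j →
  lookup (lookup (tabulate λ i → tabulate (f i)) i) j ≡ f i j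
lookup²∘tabulate² f i j =
  trans (cong (λ row → lookup row j) (lookup∘tabulate (λ i → tabulate (f i)) i))
        (lookup∘tabulate (f i) j)

tabulate²∘lookup² : ∀ {n} {B : Set} (M : Vec (Vec B n) n) {f : Fin n → Fin n → B} →
  (∀ i j → lookup (lookup M i) j ≡ f i j) → M ≡ tabulate λ i → tabulate (f i)
tabulate²∘lookup² M eq = trans (sym (tabulate∘lookup M)) (tabulate-cong λ i →
  trans (sym (tabulate∘lookup (lookup M i))) (tabulate-cong (eq i)))

-- π j is the parent of vertex suc j; the root zero has no parent.
isParent : ∀ {n} → (Fin n → Fin (suc n)) → Fin (suc n) → Fin (suc n) → Bool
isParent π i zero = false
isParent π i (suc j) = does (i ≟ π j)

parentTree : ∀ {n} → (Fin n → Fin (suc n)) → Adj (suc n)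
parentTree π = tabulate λ i → tabulate (isParent π i)

StripParents : ∀ {n} → (Fin n → Fin (suc n)) → Set
StripParents π = ∀ j → StripEdge (π j) (suc j)

module _ {n} {π : Fin n → Fin (suc n)} where

  parentTree-edge : ∀ j → HasEdge (parentTree π) (π j) (suc j)
  parentTree-edge j =
    trans (lookup²∘tabulate² (isParent π) (π j) (suc j)) (dec-true (π j ≟ π j) refl)

  parentTree-edge⁻ : ∀ i j → HasEdge (parentTree π) i (suc j) → i ≡ π j
  -- The `no` case is absurd: the entry it forces is false ≡ true.
  parentTree-edge⁻ i j e with i ≟ π j | trans (sym (lookup²∘tabulate² (isParent π) i (suc j))) e
  ... | yes i≡πj | _ = i≡πj

  parentTree-noEdgeToRoot : ∀ i → ¬ HasEdge (parentTree π) i zero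
  parentTree-noEdgeToRoot i e with () ← trans (sym (lookup²∘tabulate² (isParent π) i zero)) e

  parentTree-inDeg : ∀ j → inDeg (parentTree π) (suc j) ≡ 1
  parentTree-inDeg j = trans (inDeg≡ones-column (parentTree π) (suc j))
    (indicator⇒ones≡1 _ λ i → trans (lookup-column (parentTree π) i (suc j))
                                    (lookup²∘tabulate² (isParent π) i (suc j)))

  rootWalk : (∀ j → π j < suc j) → ∀ v → Acc _<_ v → DWalk (parentTree π) zero v
  rootWalk desc zero _ = here
  rootWalk desc (suc j) (acc rs) = snocᵈ (rootWalk desc (π j) (rs (desc j))) (parentTree-edge j)

  parentTree-strip : StripParents π → SubgraphOfStrip (parentTree π)
  parentTree-strip sp i zero e = ⊥-elim (parentTree-noEdgeToRoot i e)
  parentTree-strip sp i (suc j) e rewrite parentTree-edge⁻ i j e = sp j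

  parentTree-isTree : StripParents π → IsDirSpanningTree (parentTree π) zero
  parentTree-isTree sp =
      strip
    , reachable⇒connected fromRoot
    , strip⇒acyclic strip
    , (λ { zero z≢z → ⊥-elim (z≢z refl) ; (suc j) _ → parentTree-inDeg j })
    , (λ v _ → fromRoot v)
    where
    strip = parentTree-strip sp
    fromRoot = λ v → rootWalk (λ j → proj₁ (sp j)) v (<-wellFounded v)

spanningTree⇒parentTree : ∀ {n} {A : Adj (suc n)} → IsDirSpanningTree A zero →
  ∃ λ π → StripParents π × A ≡ parentTree π
spanningTree⇒parentTree {n} {A} (strip , _ , _ , deg , _) = π , stripParents , A≡parentTree
  where
  parentOf : ∀ j → ∃ (IsIndicatorOf (column A (suc j)))
  parentOf j = ones≡1⇒indicator (column A (suc j))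
    (trans (sym (inDeg≡ones-column A (suc j))) (deg (suc j) λ ()))

  π : Fin n → Fin (suc n)
  π j = proj₁ (parentOf j)

  entry : ∀ i j → lookup (lookup A i) j ≡ isParent π i j
  entry i zero = ¬-not λ e → noStripEdgeToRoot (strip i zero e)
    where
    noStripEdgeToRoot : ¬ StripEdge i zero
    noStripEdgeToRoot (() , _)
  entry i (suc j) = trans (sym (lookup-column A i (suc j))) (proj₂ (parentOf j) i)

  A≡parentTree : A ≡ parentTree π
  A≡parentTree = tabulate²∘lookup² A entry

  stripParents : StripParents π
  stripParents j =
    strip (π j) (suc j)
      (subst (λ B → HasEdge B (π j) (suc j)) (sym A≡parentTree) (parentTree-edge {π = π} j))

parentTree-injective : ∀ {n} {π ρ : Fin n → Fin (suc n)} →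
  parentTree π ≡ parentTree ρ → ∀ j → π j ≡ ρ j
parentTree-injective {π = π} {ρ} eq j = parentTree-edge⁻ {π = ρ} (π j) j
  (subst (λ B → HasEdge B (π j) (suc j)) eq (parentTree-edge {π = π} j))

parentTree-cong : ∀ {n} {π ρ : Fin n → Fin (suc n)} →
  (∀ j → π j ≡ ρ j) → parentTree π ≡ parentTree ρ
parentTree-cong {π = π} {ρ} eq = tabulate-cong λ i →
  tabulate-cong {f = isParent π i} {isParent ρ i} λ
    { zero → refl
    ; (suc j) → cong (λ p → does (i ≟ p)) (eq j) }

-- Bit t of c says whether vertex suc (suc t) hangs from t rather than from suc t.
stripParent : ∀ {m} → Vec Bool m → Fin (suc m) → Fin (suc (suc m))
stripParent c zero = zero
stripParent c (suc t) = if lookup c t then inject₁ (inject₁ t) else inject₁ (suc t)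

stripTree : ∀ {m} → Vec Bool m → Adj (suc (suc m))
stripTree c = parentTree (stripParent c)

stripEdge-adjacent : ∀ {n} (j : Fin n) → StripEdge (inject₁ j) (suc j)
stripEdge-adjacent j rewrite toℕ-inject₁ j = n<1+n (toℕ j) , n≤1+n (suc (toℕ j))

stripEdge-skip : ∀ {m} (t : Fin m) → StripEdge (inject₁ (inject₁ t)) (suc (suc t))
stripEdge-skip t rewrite toℕ-inject₁ (inject₁ t) | toℕ-inject₁ t = s≤s (n≤1+n (toℕ t)) , ≤-refl

stripEdge-root : ∀ {m} {p : Fin (suc (suc m))} → StripEdge p (suc zero) → p ≡ zero
stripEdge-root {p = zero} _ = refl
stripEdge-root {p = suc p} (s≤s () , _)

stripEdge-cases : ∀ {m} {p : Fin (suc (suc m))} (t : Fin m) → StripEdge p (suc (suc t)) →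
  p ≡ inject₁ (inject₁ t) ⊎ p ≡ inject₁ (suc t)
stripEdge-cases {p = zero} zero _ = inj₁ refl
stripEdge-cases {p = suc zero} zero _ = inj₂ refl
stripEdge-cases {p = suc (suc p)} zero (s≤s (s≤s ()) , _)
stripEdge-cases {p = zero} (suc t) (_ , s≤s (s≤s ()))
stripEdge-cases {p = suc p} (suc t) (s≤s lt , s≤s le) with stripEdge-cases t (lt , le)
... | inj₁ eq = inj₁ (cong suc eq)
... | inj₂ eq = inj₂ (cong suc eq)

skip≢adjacent : ∀ {m} (t : Fin m) → inject₁ (inject₁ t) ≢ inject₁ (suc t)
skip≢adjacent zero ()
skip≢adjacent (suc t) eq = skip≢adjacent t (suc-injective eq)

stripParent-strip : ∀ {m} (c : Vec Bool m) → StripParents (stripParent c)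
stripParent-strip {m} c zero = stripEdge-adjacent {suc m} zero
stripParent-strip c (suc t) with lookup c t
... | true = stripEdge-skip t
... | false = stripEdge-adjacent (suc t)

stripParents⇒stripParent : ∀ {m} {π : Fin (suc m) → Fin (suc (suc m))} → StripParents π →
  ∃ λ c → ∀ j → π j ≡ stripParent c j
stripParents⇒stripParent {π = π} sp = tabulate (λ t → proj₁ (choice t)) , agree
  where
  choice : ∀ t → ∃ λ b → π (suc t) ≡ (if b then inject₁ (inject₁ t) else inject₁ (suc t))
  choice t with stripEdge-cases t (sp (suc t))
  ... | inj₁ eq = true , eq
  ... | inj₂ eq = false , eq

  agree : ∀ j → π j ≡ stripParent (tabulate (λ t → proj₁ (choice t))) j
  agree zero = stripEdge-root (sp zero)
  agree (suc t) rewrite lookup∘tabulate (λ t → proj₁ (choice t)) t = proj₂ (choice t)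

stripTree-injective : ∀ {m} {c d : Vec Bool m} → stripTree c ≡ stripTree d → c ≡ d
stripTree-injective {c = c} {d} eq =
  trans (sym (tabulate∘lookup c)) (trans (tabulate-cong sameBit) (tabulate∘lookup d))
  where
  sameParent : ∀ j → stripParent c j ≡ stripParent d j
  sameParent = parentTree-injective {π = stripParent c} {stripParent d} eq

  sameBit : ∀ t → lookup c t ≡ lookup d t
  sameBit t with lookup c t | lookup d t | sameParent (suc t)
  ... | true | true | _ = refl
  ... | false | false | _ = refl
  ... | true | false | e = ⊥-elim (skip≢adjacent t e)
  ... | false | true | e = ⊥-elim (skip≢adjacent t (sym e))

stripTree-isTree : ∀ {m} (c : Vec Bool m) → IsDirSpanningTree (stripTree c) zero
stripTree-isTree c = parentTree-isTree (stripParent-strip c)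

spanningTree⇒stripTree : ∀ {m} {A : Adj (suc (suc m))} → IsDirSpanningTree A zero →
  ∃ λ c → A ≡ stripTree c
spanningTree⇒stripTree tree with spanningTree⇒parentTree tree
... | π , sp , refl with stripParents⇒stripParent sp
...   | c , agree = c , parentTree-cong agree

lemma2p6 : (m : ℕ) →
    Σ (List (Adj (suc (suc m)))) λ L →
    Unique L
    × ((A : Adj (suc (suc m))) → (A ∈ L) ⇔ IsDirSpanningTree A zero)
    × (length L ≡ J m + J (suc m))
lemma2p6 m =
    map stripTree (boolVecs m)
  , map⁺ stripTree-injective (boolVecs-unique m)
  , (λ A → mk⇔ member⇒tree tree⇒member)
  , trans (length-map stripTree (boolVecs m)) (trans (length-boolVecs m) (sym (J+J-suc≡2^ m)))
  where
  member⇒tree : ∀ {A} → A ∈ map stripTree (boolVecs m) → IsDirSpanningTree A zero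
  member⇒tree A∈ with ∈-map⁻ stripTree A∈
  ... | c , _ , refl = stripTree-isTree c

  tree⇒member : ∀ {A} → IsDirSpanningTree A zero → A ∈ map stripTree (boolVecs m)
  tree⇒member tree with spanningTree⇒stripTree tree
  ... | c , refl = ∈-map⁺ stripTree (boolVecs-complete c)
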